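{- In ${\sf RT}(\mathcal S)$, the Sierpinski object, viewed as the subobject $\Omega'=\{p\in\Omega\mid\exists X{:}S\,(p\leftrightarrow 1\in X)\}$ of $\Omega$, is not closed under finite unions (binary disjunction). In particular, the statement $\forall X{:}S\,\forall Y{:}S\,\exists Z{:}S\,(1\in Z\leftrightarrow(1\in X\vee 1\in Y))$ is not valid in ${\sf RT}(\mathcal S)$.
   Context: $\mathcal S$ is Scott's graph model $\mathcal P(\mathbb N)$ with application $UV=\{n\mid \exists m\,(e_m\subseteq V\wedge\langle m,n\rangle\in U)\}$ ($e_m$ the finite set with $m=\sum_{k\in e_m}2^k$, $\langle\cdot,\cdot\rangle$ a fixed pairing bijection); ${\sf RT}(\mathcal S)$ is its realizability topos with subobject classifier $\Omega$ and natural numbers object $N$. $S=(\mathcal S,U\mapsto\{U\})$ is the object of realizers. The relation $\in$ between $N$ and $S$ is given by $[n\in U]=\{{\sf p}\overline nU\}$ if $n\in U$ and $\emptyset$ otherwise (${\sf p}$ the pairing combinator, $\overline n=\{n\}$). $\Omega'$ is isomorphic to the Sierpinski object $\Sigma=(\{0,1\},E_\Sigma)$, $E_\Sigma(0)=\{\emptyset\}$, $E_\Sigma(1)=\{\{1\}\}$. -}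

module Defs where

open import Level using (Lift)
import Level
open import Data.Nat using (ℕ; zero; suc; _+_; _/_; _%_)
open import Data.Product using (Σ; _×_)
open import Data.Sum using (_⊎_)
open import Relation.Binary.PropositionalEquality using (_≡_)

-- Scott's graph model  𝒮 = P(ℕ)   (subsets of ℕ as predicates)

𝒮 : Set₁
𝒮 = ℕ → Set

_⊆_ : 𝒮 → 𝒮 → Set
U ⊆ V = ∀ k → U k → V k

_≐_ : 𝒮 → 𝒮 → Set
U ≐ V = (U ⊆ V) × (V ⊆ U)

bit : ℕ → ℕ → ℕ
bit m zero    = m % 2
bit m (suc k) = bit (m / 2) k

-- e_m : the finite set with m = Σ_{k ∈ e_m} 2^k
e : ℕ → 𝒮
e m k = bit m k ≡ 1

-- the fixed pairing bijection ℕ × ℕ → ℕ (Cantor pairing)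
tri : ℕ → ℕ
tri zero    = zero
tri (suc k) = suc k + tri k

⟨_,_⟩ : ℕ → ℕ → ℕ
⟨ m , n ⟩ = tri (m + n) + n

infixl 9 _·_
_·_ : 𝒮 → 𝒮 → 𝒮
(U · V) n = Σ ℕ λ m → (e m ⊆ V) × U ⟨ m , n ⟩

Fun : (𝒮 → 𝒮) → 𝒮
Fun f k = Σ ℕ λ m → Σ ℕ λ n → (k ≡ ⟨ m , n ⟩) × f (e m) n

p : 𝒮
p = Fun (λ a → Fun (λ b → Fun (λ z → z · a · b)))

‾ : ℕ → 𝒮
‾ n k = k ≡ n

-- Realizability interpretation of formulas in RT(𝒮):
-- a truth value is a set of realizers (a predicate on 𝒮).

RSet : Set₂
RSet = 𝒮 → Set₁

⟦1∈_⟧ : 𝒮 → RSet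
⟦1∈ X ⟧ r = Lift (Level.suc Level.zero) (X 1 × (r ≐ (p · ‾ 1 · X)))

infixr 6 _∧_
infixr 5 _∨_
infixr 4 _⇒_ _⇔_

_∧_ : RSet → RSet → RSet
(A ∧ B) r = Σ 𝒮 λ a → Σ 𝒮 λ b → A a × B b × Lift (Level.suc Level.zero) (r ≐ (p · a · b))

_∨_ : RSet → RSet → RSet
(A ∨ B) r = (Σ 𝒮 λ a → A a × Lift (Level.suc Level.zero) (r ≐ (p · ‾ 0 · a)))
          ⊎ (Σ 𝒮 λ b → B b × Lift (Level.suc Level.zero) (r ≐ (p · ‾ 1 · b)))

_⇒_ : RSet → RSet → RSet
(A ⇒ B) r = ∀ a → A a → B (r · a)

_⇔_ : RSet → RSet → RSet
A ⇔ B = (A ⇒ B) ∧ (B ⇒ A)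

-- quantifiers over the object of realizers S = (𝒮, U ↦ {U})
∀S : (𝒮 → RSet) → RSet
∀S φ r = ∀ X → φ X (r · X)

∃S : (𝒮 → RSet) → RSet
∃S φ r = Σ 𝒮 λ X → Σ 𝒮 λ s → φ X s × Lift (Level.suc Level.zero) (r ≐ (p · X · s))

Valid : RSet → Set₁
Valid A = Σ 𝒮 A

module Submission where

-- Suppose r realizes  ∀X ∀Y ∃Z (1 ∈ Z ↔ 1 ∈ X ∨ 1 ∈ Y).  From r · X · Y
-- one extracts, by fixed applications in 𝒮, the witness Z and the realizer f of the
-- implication (1 ∈ Z) → (1 ∈ X ∨ 1 ∈ Y); feeding f the canonical realizer p 1̄ Z of
-- 1 ∈ Z and projecting yields the "tag" of the disjunct chosen: 0̄ for the left one,
-- 1̄ for the right one.  Since application in 𝒮 is monotone, so is the tag as a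
-- function of (X, Y).  With X = {1} and Y = ∅ the tag must be 0̄, with X = ∅ and
-- Y = {1} it must be 1̄, so the tag at X = Y = {1} contains both 0 and 1 — but it is
-- a single numeral.  Continuity of the realizer is thus incompatible with union.

open import Defs
open import Relation.Nullary using (¬_)
open import Level using (lift; lower)
open import Data.Nat using (ℕ; zero; suc; _+_; _^_; _≤_; _<_; z≤n; s≤s; _/_; _%_)
open import Data.Nat.Properties
open import Data.Nat.DivMod using (m*n%n≡0; m*n/n≡m)
open import Data.Product using (Σ; _×_; _,_; proj₁; proj₂)
open import Data.Sum using (_⊎_; inj₁; inj₂)
open import Data.Empty using (⊥)
open import Relation.Binary.PropositionalEquality
open import Relation.Binary using (tri<; tri≈; tri>)
open import Relation.Nullary using (contradiction)

⊆-refl : ∀ {U : 𝒮} → U ⊆ U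
⊆-refl k u = u

⊆-trans : ∀ {U V W : 𝒮} → U ⊆ V → V ⊆ W → U ⊆ W
⊆-trans U⊆V V⊆W k u = V⊆W k (U⊆V k u)

≐-refl : ∀ {U : 𝒮} → U ≐ U
≐-refl = ⊆-refl , ⊆-refl

≐-trans : ∀ {U V W : 𝒮} → U ≐ V → V ≐ W → U ≐ W
≐-trans (U⊆V , V⊆U) (V⊆W , W⊆V) = ⊆-trans U⊆V V⊆W , ⊆-trans W⊆V V⊆U

-- Application only inspects finite subsets of its argument, hence is monotone in
-- both places; this is the continuity the whole argument rests on.
app-mono : ∀ {U U' V V' : 𝒮} → U ⊆ U' → V ⊆ V' → (U · V) ⊆ (U' · V')
app-mono U⊆U' V⊆V' n (m , em⊆V , u) = m , ⊆-trans em⊆V V⊆V' , U⊆U' _ u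

app-≐ : ∀ {U U' V V' : 𝒮} → U ≐ U' → V ≐ V' → (U · V) ≐ (U' · V')
app-≐ (U⊆U' , U'⊆U) (V⊆V' , V'⊆V) = app-mono U⊆U' V⊆V' , app-mono U'⊆U V'⊆V

bit-zero : ∀ k → bit 0 k ≡ 0
bit-zero zero    = refl
bit-zero (suc k) = bit-zero k

e-zero⊆ : ∀ {V : 𝒮} → e 0 ⊆ V
e-zero⊆ k k∈e0 with trans (sym (bit-zero k)) k∈e0
... | ()

half-pow : ∀ n → 2 ^ suc n / 2 ≡ 2 ^ n
half-pow n = trans (cong (_/ 2) (*-comm 2 (2 ^ n))) (m*n/n≡m (2 ^ n) 2)

parity-pow : ∀ n → 2 ^ suc n % 2 ≡ 0
parity-pow n = trans (cong (_% 2) (*-comm 2 (2 ^ n))) (m*n%n≡0 (2 ^ n) 2)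

bit-pow : ∀ n k → bit (2 ^ n) k ≡ 1 → k ≡ n
bit-pow zero    zero    _   = refl
bit-pow zero    (suc k) set with trans (sym (bit-zero k)) set
... | ()
bit-pow (suc n) zero    set with trans (sym (parity-pow n)) set
... | ()
bit-pow (suc n) (suc k) set =
  cong suc (bit-pow n k (trans (cong (λ x → bit x k) (sym (half-pow n))) set))

bit-pow-self : ∀ n → e (2 ^ n) n
bit-pow-self zero    = refl
bit-pow-self (suc n) = trans (cong (λ x → bit x n) (half-pow n)) (bit-pow-self n)

e-pow⊆ : ∀ {j} {V : 𝒮} → V j → e (2 ^ j) ⊆ V
e-pow⊆ {j} {V} j∈V k k∈e = subst V (sym (bit-pow j k k∈e)) j∈V

-- Injectivity of the Cantor pairing ⟨ m , n ⟩ = tri (m + n) + n: the codes with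
-- diagonal s = m + n fill exactly the interval [tri s, tri (suc s)).

tri-mono : ∀ {m n} → m ≤ n → tri m ≤ tri n
tri-mono {zero}  _         = z≤n
tri-mono {suc m} (s≤s m≤n) = +-mono-≤ (s≤s m≤n) (tri-mono m≤n)

pair-below : ∀ a b → ⟨ a , b ⟩ < tri (suc (a + b))
pair-below a b = s≤s (subst (λ x → x ≤ (a + b) + tri (a + b)) (+-comm b (tri (a + b)))
  (+-mono-≤ (m≤n+m b a) ≤-refl))

pair-above : ∀ a b → tri (a + b) ≤ ⟨ a , b ⟩
pair-above a b = m≤m+n (tri (a + b)) b

pair-diagonal : ∀ a b c d → ⟨ a , b ⟩ ≡ ⟨ c , d ⟩ → a + b ≡ c + d
pair-diagonal a b c d eq with <-cmp (a + b) (c + d)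
... | tri≈ _ same _ = same
... | tri< lt _ _ = contradiction (≤-reflexive (sym eq))
  (<⇒≱ (≤-trans (pair-below a b) (≤-trans (tri-mono lt) (pair-above c d))))
... | tri> _ _ gt = contradiction (≤-reflexive eq)
  (<⇒≱ (≤-trans (pair-below c d) (≤-trans (tri-mono gt) (pair-above a b))))

pair-injective : ∀ {a b c d} → ⟨ a , b ⟩ ≡ ⟨ c , d ⟩ → (a ≡ c) × (b ≡ d)
pair-injective {a} {b} {c} {d} eq = a≡c , b≡d
  where
  s : a + b ≡ c + d
  s = pair-diagonal a b c d eq
  b≡d : b ≡ d
  b≡d = +-cancelˡ-≡ (tri (a + b)) b d (trans eq (cong (λ x → tri x + d) (sym s)))
  a≡c : a ≡ c
  a≡c = +-cancelʳ-≡ b a c (trans s (cong (c +_) (sym b≡d)))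

Fun-intro : ∀ {f : 𝒮 → 𝒮} {m n} → f (e m) n → Fun f ⟨ m , n ⟩
Fun-intro {m = m} {n} fn = m , n , refl , fn

Fun-elim : ∀ {f : 𝒮 → 𝒮} {m n} → Fun f ⟨ m , n ⟩ → f (e m) n
Fun-elim {m = m} {n} (m' , n' , eq , fn) with pair-injective {m} {n} {m'} {n'} eq
... | refl , refl = fn

p-graph-elim : ∀ {a b c n} → p ⟨ a , ⟨ b , ⟨ c , n ⟩ ⟩ ⟩ → (e c · e a · e b) n
p-graph-elim {a} {b} {c} {n} code =
  Fun-elim {λ z → z · e a · e b} {c} {n}
    (Fun-elim {λ b' → Fun (λ z → z · e a · b')} {b} {⟨ c , n ⟩}
      (Fun-elim {λ a' → Fun (λ b' → Fun (λ z → z · a' · b'))} {a} {⟨ b , ⟨ c , n ⟩ ⟩} code))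

p-graph-intro : ∀ {a b c n} → (e c · e a · e b) n → p ⟨ a , ⟨ b , ⟨ c , n ⟩ ⟩ ⟩
p-graph-intro {a} {b} {c} {n} applied =
  Fun-intro {λ a' → Fun (λ b' → Fun (λ z → z · a' · b'))} {a} {⟨ b , ⟨ c , n ⟩ ⟩}
    (Fun-intro {λ b' → Fun (λ z → z · e a · b')} {b} {⟨ c , n ⟩}
      (Fun-intro {λ z → z · e a · e b} {c} {n} applied))

p-β : ∀ {A B C : 𝒮} → (p · A · B · C) ≐ (C · A · B)
p-β {A} {B} {C} = reduce , expand
  where
  reduce : (p · A · B · C) ⊆ (C · A · B)
  reduce n (m , em⊆C , m₁ , em₁⊆B , m₂ , em₂⊆A , code) =
    app-mono {e m · e m₂} (app-mono em⊆C em₂⊆A) em₁⊆B n (p-graph-elim code)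
  -- C is only consulted on the single code ⟨ m₂ , ⟨ m₁ , n ⟩ ⟩
  expand : (C · A · B) ⊆ (p · A · B · C)
  expand n (m₁ , em₁⊆B , m₂ , em₂⊆A , c) =
    2 ^ ⟨ m₂ , ⟨ m₁ , n ⟩ ⟩ , e-pow⊆ {V = C} c , m₁ , em₁⊆B , m₂ , em₂⊆A ,
    p-graph-intro {m₂} {m₁} (m₁ , ⊆-refl , m₂ , ⊆-refl , bit-pow-self ⟨ m₂ , ⟨ m₁ , n ⟩ ⟩)

fst : 𝒮
fst = Fun (λ a → Fun (λ _ → a))

snd : 𝒮
snd = Fun (λ _ → Fun (λ b → b))

fst-graph : ∀ {a b n} → fst ⟨ a , ⟨ b , n ⟩ ⟩ → e a n
fst-graph {a} {b} {n} code =
  Fun-elim {λ _ → e a} {b} {n} (Fun-elim {λ a' → Fun (λ _ → a')} {a} {⟨ b , n ⟩} code)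

snd-graph : ∀ {a b n} → snd ⟨ a , ⟨ b , n ⟩ ⟩ → e b n
snd-graph {a} {b} {n} code =
  Fun-elim {λ b' → b'} {b} {n} (Fun-elim {λ _ → Fun (λ b' → b')} {a} {⟨ b , n ⟩} code)

fst-β : ∀ {A B : 𝒮} → (fst · A · B) ≐ A
fst-β {A} {B} = reduce , expand
  where
  reduce : (fst · A · B) ⊆ A
  reduce j (m₁ , _ , m₂ , em₂⊆A , code) = em₂⊆A j (fst-graph {m₂} {m₁} code)
  expand : A ⊆ (fst · A · B)
  expand j a = 0 , e-zero⊆ , 2 ^ j , e-pow⊆ {V = A} a ,
    Fun-intro {λ a' → Fun (λ _ → a')} {2 ^ j} {⟨ 0 , j ⟩}
      (Fun-intro {λ _ → e (2 ^ j)} {0} {j} (bit-pow-self j))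

snd-β : ∀ {A B : 𝒮} → (snd · A · B) ≐ B
snd-β {A} {B} = reduce , expand
  where
  reduce : (snd · A · B) ⊆ B
  reduce j (m₁ , em₁⊆B , m₂ , _ , code) = em₁⊆B j (snd-graph {m₂} {m₁} code)
  expand : B ⊆ (snd · A · B)
  expand j b = 2 ^ j , e-pow⊆ {V = B} b , 0 , e-zero⊆ ,
    Fun-intro {λ _ → Fun (λ b' → b')} {0} {⟨ 2 ^ j , j ⟩}
      (Fun-intro {λ b' → b'} {2 ^ j} {j} (bit-pow-self j))

π₁ : 𝒮 → 𝒮
π₁ W = W · fst

π₂ : 𝒮 → 𝒮
π₂ W = W · snd

π₁-pair : ∀ {A B : 𝒮} → π₁ (p · A · B) ≐ A
π₁-pair = ≐-trans p-β fst-β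

π₂-pair : ∀ {A B : 𝒮} → π₂ (p · A · B) ≐ B
π₂-pair = ≐-trans p-β snd-β

π₁-of : ∀ {W A B : 𝒮} → W ≐ (p · A · B) → π₁ W ≐ A
π₁-of W≐AB = ≐-trans (app-≐ W≐AB ≐-refl) π₁-pair

π₂-of : ∀ {W A B : 𝒮} → W ≐ (p · A · B) → π₂ W ≐ B
π₂-of W≐AB = ≐-trans (app-≐ W≐AB ≐-refl) π₂-pair

SierpinskiUnion : RSet
SierpinskiUnion = ∀S λ X → ∀S λ Y → ∃S λ Z → ⟦1∈ Z ⟧ ⇔ (⟦1∈ X ⟧ ∨ ⟦1∈ Y ⟧)

member : ∀ {X : 𝒮} → X 1 → ⟦1∈ X ⟧ (p · ‾ 1 · X)
member x₁ = lift (x₁ , ≐-refl)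

disjunction : ∀ {X Y : 𝒮} → X 1 ⊎ Y 1 → Σ 𝒮 (⟦1∈ X ⟧ ∨ ⟦1∈ Y ⟧)
disjunction (inj₁ x₁) = _ , inj₁ (_ , member x₁ , lift ≐-refl)
disjunction (inj₂ y₁) = _ , inj₂ (_ , member y₁ , lift ≐-refl)

empty : 𝒮
empty _ = ⊥

one : 𝒮
one = ‾ 1

empty⊆one : empty ⊆ one
empty⊆one _ ()

-- From a realizer r of SierpinskiUnion we read off, uniformly in X and Y, which
-- disjunct the union's witness is mapped to.
module DisjunctTag (r : 𝒮) (realizes : SierpinskiUnion r) where

  witness : 𝒮 → 𝒮 → 𝒮
  witness X Y = r · X · Y

  -- π₁ ∘ π₁ ∘ π₂ of the witness is the realizer of  1 ∈ Z → 1 ∈ X ∨ 1 ∈ Y,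
  -- and π₁ of the witness is Z itself.
  tag : 𝒮 → 𝒮 → 𝒮
  tag X Y = π₁ (π₁ (π₂ (witness X Y)) · (p · ‾ 1 · π₁ (witness X Y)))

  tag-mono : ∀ {X X' Y Y'} → X ⊆ X' → Y ⊆ Y' → tag X Y ⊆ tag X' Y'
  tag-mono {X} {X'} {Y} {Y'} X⊆X' Y⊆Y' =
    app-mono (app-mono (app-mono (app-mono w⊆w' ⊆-refl) ⊆-refl)
                       (app-mono (⊆-refl {p · ‾ 1}) (app-mono w⊆w' ⊆-refl)))
             ⊆-refl
    where
    w⊆w' : witness X Y ⊆ witness X' Y'
    w⊆w' = app-mono (app-mono (⊆-refl {r}) X⊆X') Y⊆Y'

  tag-unfold : ∀ {X Y Z s f g} → witness X Y ≐ (p · Z · s) → s ≐ (p · f · g) →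
               tag X Y ≐ π₁ (f · (p · ‾ 1 · Z))
  tag-unfold w≐Zs s≐fg =
    app-≐ (app-≐ (≐-trans (app-≐ (π₂-of w≐Zs) ≐-refl) (π₁-of s≐fg))
                 (app-≐ (≐-refl {p · ‾ 1}) (π₁-of w≐Zs)))
          ≐-refl

  tag-spec : ∀ X Y → X 1 ⊎ Y 1 →
             (X 1 × tag X Y ≐ ‾ 0) ⊎ (Y 1 × tag X Y ≐ ‾ 1)
  tag-spec X Y holds with realizes X Y
  ... | Z , s , (f , g , f-real , g-real , lift s≐fg) , lift w≐Zs
    with f-real (p · ‾ 1 · Z) (member (proj₁ (lower (g-real _ (proj₂ (disjunction holds))))))
  ... | inj₁ (_ , lift (x₁ , _) , lift out≐) =
    inj₁ (x₁ , ≐-trans (tag-unfold w≐Zs s≐fg) (π₁-of out≐))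
  ... | inj₂ (_ , lift (y₁ , _) , lift out≐) =
    inj₂ (y₁ , ≐-trans (tag-unfold w≐Zs s≐fg) (π₁-of out≐))

  tag-numeral : ∀ X Y → X 1 ⊎ Y 1 → Σ ℕ λ n → tag X Y ⊆ ‾ n
  tag-numeral X Y holds with tag-spec X Y holds
  ... | inj₁ (_ , t≐0) = 0 , proj₁ t≐0
  ... | inj₂ (_ , t≐1) = 1 , proj₁ t≐1

  tag-left : tag one empty 0
  tag-left with tag-spec one empty (inj₁ refl)
  ... | inj₁ (_ , t≐0) = proj₂ t≐0 0 refl
  ... | inj₂ (() , _)

  tag-right : tag empty one 1
  tag-right with tag-spec empty one (inj₂ refl)
  ... | inj₁ (() , _)
  ... | inj₂ (_ , t≐1) = proj₂ t≐1 1 refl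

proposition6p1 : ¬ Valid (∀S λ X → ∀S λ Y → ∃S λ Z → ⟦1∈ Z ⟧ ⇔ (⟦1∈ X ⟧ ∨ ⟦1∈ Y ⟧))
proposition6p1 (r , realizes) = 0≢1+n (trans (tag⊆n 0 contains-0) (sym (tag⊆n 1 contains-1)))
  where
  open DisjunctTag r realizes
  tag⊆n : tag one one ⊆ ‾ (proj₁ (tag-numeral one one (inj₁ refl)))
  tag⊆n = proj₂ (tag-numeral one one (inj₁ refl))
  contains-0 : tag one one 0
  contains-0 = tag-mono ⊆-refl empty⊆one 0 tag-left
  contains-1 : tag one one 1
  contains-1 = tag-mono empty⊆one ⊆-refl 1 tag-right
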